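{- Let $d\ge 3$ be an integer and $f(x) = -(d-1)x^d + d x^{d-1}\in\mathbb{Q}[x]$, viewed as a map $\mathbb{P}^1\to\mathbb{P}^1$. Then: (1) The fixed points of $f$ in $\mathbb{P}^1(\mathbb{Q})$ are exactly $0$, $1$, $\infty$ if $d\ge 4$, and exactly $0,1,\infty,\tfrac12$ if $d=3$. (2) The points of $\mathbb{P}^1(\mathbb{Q})$ lying in the backward orbit of one of these fixed points, other than the fixed points themselves, are exactly $\tfrac{d}{d-1}$ if $d\ge 4$, and exactly $\tfrac{d}{d-1}=\tfrac32$ and $-\tfrac12$ if $d=3$.
   Context: The backward orbit of a point $P$ under $f$ is $\bigcup_{n\ge1}\{Q\in\mathbb{P}^1 : f^n(Q)=P\}$, where $f^n$ is the $n$-fold iterate. The map $f$ is the normalized Belyi map of combinatorial type $(d; d-1, 2, d)$. -}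

module Defs where

open import Data.Nat using (ℕ; zero; suc; _∸_)
open import Data.Integer using (+_; -[1+_])
open import Data.Rational using (ℚ; _+_; _*_; -_; _/_; 0ℚ; 1ℚ; ½)

ℚnat : ℕ → ℚ
ℚnat n = + n / 1

_^ℚ_ : ℚ → ℕ → ℚ
x ^ℚ zero  = 1ℚ
x ^ℚ suc n = x * (x ^ℚ n)

data ℙ¹ : Set where
  fin : ℚ → ℙ¹
  ∞   : ℙ¹

-- f(x) = -(d-1) x^d + d x^(d-1), extended to ℙ¹ (f(∞) = ∞ since deg f = d ≥ 1)
fpoly : ℕ → ℚ → ℚ
fpoly d x = (- ℚnat (d ∸ 1)) * (x ^ℚ d) + ℚnat d * (x ^ℚ (d ∸ 1))

f : ℕ → ℙ¹ → ℙ¹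
f d (fin x) = fin (fpoly d x)
f d ∞       = ∞

iter : ℕ → ℕ → ℙ¹ → ℙ¹
iter d zero    P = P
iter d (suc n) P = f d (iter d n P)

IsFixed : ℕ → ℙ¹ → Set
IsFixed d P = f d P ≡ P
  where open import Relation.Binary.PropositionalEquality using (_≡_)

InBackwardOrbit : ℕ → ℙ¹ → ℙ¹ → Set
InBackwardOrbit d P Q = Σ ℕ (λ n → iter d (suc n) Q ≡ P)
  where open import Data.Product using (Σ)
        open import Relation.Binary.PropositionalEquality using (_≡_)

-- the rational number d/(d-1) (for d ≥ 2; junk value 0 otherwise)
d/d-1 : ℕ → ℚ
d/d-1 (suc (suc m)) = + suc (suc m) / suc m
d/d-1 _             = 0ℚ

-½ : ℚ
-½ = -[1+ 0 ] / 2

-- Write x = p / q in lowest terms and d = m + 1, so that f x = p ^ m (d q - m p) / q ^ d.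
-- The equation f x = A / B becomes B p ^ m (d q - m p) = A q ^ d, whence p ^ m divides A and
-- q divides B m p ^ d (the rational root theorem).  For f x = x and f x = 1 this forces p = ±1,
-- leaving Diophantine equations such as (m + 1) q = q ^ m + m in which the growth of q ^ m
-- leaves only q = 1, or q = 2 when m = 2.  For f x = ±½ (d = 3) only x = ±1 / n with n ∣ 4
-- remain, and these are evaluated.  f x = 0 factors into x = 0 or x = d / (d - 1), and
-- f x = d / (d - 1) would force p = ±1 and then d ∣ m ^ 2, although m ^ 2 ≡ 1 (mod d).
-- So the listed fixed points together with d / (d - 1) (and -½ when d = 3) form a set that
-- contains the rational preimages of its points, hence every backward orbit of a fixed point.
module Submission where

open import Defs
open import Data.Nat using (ℕ; zero; suc; _+_; _*_; _^_; _≤_; _<_; z≤n; s≤s)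
open import Data.Nat.Properties
  using ( ≤-refl; ≤-reflexive; ≤-trans; ≤-antisym; ≤-<-trans; <-≤-trans; <⇒≢; <⇒≱; n<1+n
        ; m≤m+n; m<m+n; m≤m*n; +-monoˡ-≤; +-monoʳ-<; *-monoˡ-≤; *-monoʳ-≤; *-mono-≤
        ; *-comm; *-identityˡ; *-identityʳ; *-zeroʳ; ^-zeroˡ; m^n≡1⇒n≡0∨m≡1; n≢0⇒n>0; 1+n≢0
        ; module ≤-Reasoning)
open import Data.Nat.Divisibility using (_∣_; divides; ∣1⇒≡1; ∣-trans; ∣⇒≤; 0∣⇒≡0; ∣m+n∣m⇒∣n; n∣m*n)
open import Data.Nat.Coprimality as Coprime using (Coprime; coprime-divisor)
open import Data.Nat.Tactic.RingSolver using (solve)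
open import Data.Integer as ℤ using (ℤ; +_; -[1+_]; ∣_∣; 0ℤ; 1ℤ; -1ℤ)
import Data.Integer.Properties as ℤP
open import Data.Integer.Tactic.RingSolver using (solve-∀)
import Algebra.Properties.CommutativeSemigroup ℤP.*-commutativeSemigroup as ℤ*
open import Data.Rational as ℚ using (ℚ; mkℚ; ↥_; ↧_; ↧ₙ_; toℚᵘ; _/_; 0ℚ; 1ℚ; ½)
import Data.Rational.Properties as ℚP
import Data.Rational.Solver as ℚSolver
open import Data.Rational.Unnormalised as ℚᵘ using (mkℚᵘ; *≡*)
import Data.Rational.Unnormalised.Properties as ℚᵘP
open import Data.List using (_∷_; [])
open import Data.Product using (_×_; _,_; Σ)
open import Data.Sum using (_⊎_; inj₁; inj₂; [_,_])
open import Data.Empty using (⊥-elim)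
open import Relation.Nullary using (¬_; yes; no)
open import Relation.Binary.PropositionalEquality
  using (_≡_; _≢_; refl; sym; trans; cong; cong₂; subst; module ≡-Reasoning)
open import Function.Bundles using (_⇔_; mk⇔)

fromℤ : ℤ → ℚ
fromℤ i = i / 1

toℚᵘ-fromℤ : ∀ i → toℚᵘ (fromℤ i) ℚᵘ.≃ mkℚᵘ i 0
toℚᵘ-fromℤ i = ℚP.toℚᵘ-fromℚᵘ (mkℚᵘ i 0)

fromℤ-injective : ∀ {i j} → fromℤ i ≡ fromℤ j → i ≡ j
fromℤ-injective {i} {j} eq
  with ℚᵘP.≃-trans (ℚᵘP.≃-sym (toℚᵘ-fromℤ i)) (ℚᵘP.≃-trans (ℚP.toℚᵘ-cong eq) (toℚᵘ-fromℤ j))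
... | *≡* i*1≡j*1 = trans (sym (ℤP.*-identityʳ i)) (trans i*1≡j*1 (ℤP.*-identityʳ j))

fromℤ-+ : ∀ i j → fromℤ (i ℤ.+ j) ≡ fromℤ i ℚ.+ fromℤ j
fromℤ-+ i j = ℚP.toℚᵘ-injective (begin
  toℚᵘ (fromℤ (i ℤ.+ j))               ≈⟨ toℚᵘ-fromℤ (i ℤ.+ j) ⟩
  mkℚᵘ (i ℤ.+ j) 0                      ≈⟨ *≡* (distrib i j) ⟩
  mkℚᵘ i 0 ℚᵘ.+ mkℚᵘ j 0                ≈⟨ ℚᵘP.+-cong (toℚᵘ-fromℤ i) (toℚᵘ-fromℤ j) ⟨
  toℚᵘ (fromℤ i) ℚᵘ.+ toℚᵘ (fromℤ j)    ≈⟨ ℚP.toℚᵘ-homo-+ (fromℤ i) (fromℤ j) ⟨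
  toℚᵘ (fromℤ i ℚ.+ fromℤ j)            ∎)
  where
  open ℚᵘP.≃-Reasoning
  distrib : ∀ i j → (i ℤ.+ j) ℤ.* 1ℤ ≡ (i ℤ.* 1ℤ ℤ.+ j ℤ.* 1ℤ) ℤ.* 1ℤ
  distrib = solve-∀

fromℤ-* : ∀ i j → fromℤ (i ℤ.* j) ≡ fromℤ i ℚ.* fromℤ j
fromℤ-* i j = ℚP.toℚᵘ-injective (begin
  toℚᵘ (fromℤ (i ℤ.* j))               ≈⟨ toℚᵘ-fromℤ (i ℤ.* j) ⟩
  mkℚᵘ i 0 ℚᵘ.* mkℚᵘ j 0                ≈⟨ ℚᵘP.*-cong (toℚᵘ-fromℤ i) (toℚᵘ-fromℤ j) ⟨
  toℚᵘ (fromℤ i) ℚᵘ.* toℚᵘ (fromℤ j)    ≈⟨ ℚP.toℚᵘ-homo-* (fromℤ i) (fromℤ j) ⟨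
  toℚᵘ (fromℤ i ℚ.* fromℤ j)            ∎)
  where open ℚᵘP.≃-Reasoning

fromℤ-neg : ∀ i → fromℤ (ℤ.- i) ≡ ℚ.- fromℤ i
fromℤ-neg i = ℚP.toℚᵘ-injective (begin
  toℚᵘ (fromℤ (ℤ.- i))     ≈⟨ toℚᵘ-fromℤ (ℤ.- i) ⟩
  ℚᵘ.- mkℚᵘ i 0            ≈⟨ ℚᵘP.-‿cong (toℚᵘ-fromℤ i) ⟨
  ℚᵘ.- toℚᵘ (fromℤ i)      ≈⟨ ℚP.toℚᵘ-homo‿- (fromℤ i) ⟨
  toℚᵘ (ℚ.- fromℤ i)       ∎)
  where open ℚᵘP.≃-Reasoning

fromℤ-^ : ∀ i n → fromℤ (i ℤ.^ n) ≡ fromℤ i ^ℚ n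
fromℤ-^ i zero    = refl
fromℤ-^ i (suc n) = trans (fromℤ-* i (i ℤ.^ n)) (cong (fromℤ i ℚ.*_) (fromℤ-^ i n))

/-*-fromℤ : ∀ i n → (i / suc n) ℚ.* fromℤ (+ suc n) ≡ fromℤ i
/-*-fromℤ i n = ℚP.toℚᵘ-injective (begin
  toℚᵘ ((i / suc n) ℚ.* fromℤ (+ suc n))         ≈⟨ ℚP.toℚᵘ-homo-* (i / suc n) (fromℤ (+ suc n)) ⟩
  toℚᵘ (i / suc n) ℚᵘ.* toℚᵘ (fromℤ (+ suc n))   ≈⟨ ℚᵘP.*-cong (ℚP.toℚᵘ-fromℚᵘ (mkℚᵘ i n)) (toℚᵘ-fromℤ (+ suc n)) ⟩
  mkℚᵘ i n ℚᵘ.* mkℚᵘ (+ suc n) 0                 ≈⟨ *≡* i[1+n]≡i[1+n*1] ⟩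
  mkℚᵘ i 0                                       ≈⟨ toℚᵘ-fromℤ i ⟨
  toℚᵘ (fromℤ i)                                 ∎)
  where
  open ℚᵘP.≃-Reasoning
  i[1+n]≡i[1+n*1] : i ℤ.* + suc n ℤ.* 1ℤ ≡ i ℤ.* + suc (n * 1)
  i[1+n]≡i[1+n*1] = trans (ℤP.*-identityʳ _) (cong (λ k → i ℤ.* + suc k) (sym (*-identityʳ n)))

*-↧≡↥ : ∀ x → x ℚ.* fromℤ (↧ x) ≡ fromℤ (↥ x)
*-↧≡↥ x = trans (cong (ℚ._* fromℤ (↧ x)) (sym (ℚP.↥p/↧p≡p x))) (/-*-fromℤ (↥ x) (ℚ.denominator-1 x))

ℚ-*-cancelʳ-≡ : ∀ a b c → c ≢ 0ℚ → a ℚ.* c ≡ b ℚ.* c → a ≡ b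
ℚ-*-cancelʳ-≡ a b c c≢0 ac≡bc = begin
  a                        ≡⟨ ℚP.*-identityʳ a ⟨
  a ℚ.* 1ℚ                 ≡⟨ cong (a ℚ.*_) (ℚP.*-inverseʳ c) ⟨
  a ℚ.* (c ℚ.* ℚ.1/ c)     ≡⟨ ℚP.*-assoc a c _ ⟨
  (a ℚ.* c) ℚ.* ℚ.1/ c     ≡⟨ cong (ℚ._* ℚ.1/ c) ac≡bc ⟩
  (b ℚ.* c) ℚ.* ℚ.1/ c     ≡⟨ ℚP.*-assoc b c _ ⟩
  b ℚ.* (c ℚ.* ℚ.1/ c)     ≡⟨ cong (b ℚ.*_) (ℚP.*-inverseʳ c) ⟩
  b ℚ.* 1ℚ                 ≡⟨ ℚP.*-identityʳ b ⟩
  b                        ∎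
  where
  open ≡-Reasoning
  instance
    _ : ℚ.NonZero c
    _ = ℚ.≢-nonZero c≢0

^ℚ-distribʳ-* : ∀ x y n → (x ℚ.* y) ^ℚ n ≡ (x ^ℚ n) ℚ.* (y ^ℚ n)
^ℚ-distribʳ-* x y zero    = refl
^ℚ-distribʳ-* x y (suc n) = begin
  (x ℚ.* y) ℚ.* (x ℚ.* y) ^ℚ n            ≡⟨ cong ((x ℚ.* y) ℚ.*_) (^ℚ-distribʳ-* x y n) ⟩
  (x ℚ.* y) ℚ.* ((x ^ℚ n) ℚ.* (y ^ℚ n))   ≡⟨ solveℚ 4 (λ x y X Y → (x :* y) :* (X :* Y) := (x :* X) :* (y :* Y))
                                                refl x y (x ^ℚ n) (y ^ℚ n) ⟩
  (x ℚ.* (x ^ℚ n)) ℚ.* (y ℚ.* (y ^ℚ n))   ∎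
  where
  open ≡-Reasoning
  open ℚSolver.+-*-Solver using (_:*_; _:=_) renaming (solve to solveℚ)

1^ℚ : ∀ n → 1ℚ ^ℚ n ≡ 1ℚ
1^ℚ zero    = refl
1^ℚ (suc n) = trans (ℚP.*-identityˡ (1ℚ ^ℚ n)) (1^ℚ n)

fpoly-factored : ∀ m x → fpoly (suc m) x ≡ (x ^ℚ m) ℚ.* (ℚnat (suc m) ℚ.- ℚnat m ℚ.* x)
fpoly-factored m x = solveℚ 4 (λ X D M x → (:- M) :* (x :* X) :+ D :* X := X :* (D :+ :- (M :* x)))
  refl (x ^ℚ m) (ℚnat (suc m)) (ℚnat m) x
  where open ℚSolver.+-*-Solver using (_:+_; _:*_; :-_; _:=_) renaming (solve to solveℚ)

fpoly-0 : ∀ m → fpoly (suc (suc m)) 0ℚ ≡ 0ℚ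
fpoly-0 m = begin
  fpoly (suc (suc m)) 0ℚ               ≡⟨ fpoly-factored (suc m) 0ℚ ⟩
  (0ℚ ℚ.* (0ℚ ^ℚ m)) ℚ.* r             ≡⟨ cong (ℚ._* r) (ℚP.*-zeroˡ (0ℚ ^ℚ m)) ⟩
  0ℚ ℚ.* r                             ≡⟨ ℚP.*-zeroˡ r ⟩
  0ℚ                                   ∎
  where
  open ≡-Reasoning
  r = ℚnat (suc (suc m)) ℚ.- ℚnat (suc m) ℚ.* 0ℚ

fpoly-1 : ∀ m → fpoly (suc m) 1ℚ ≡ 1ℚ
fpoly-1 m = begin
  fpoly (suc m) 1ℚ                                 ≡⟨ fpoly-factored m 1ℚ ⟩
  (1ℚ ^ℚ m) ℚ.* (ℚnat (suc m) ℚ.- ℚnat m ℚ.* 1ℚ)   ≡⟨ cong₂ ℚ._*_ (1^ℚ m) (cong (λ u → ℚnat (suc m) ℚ.- u) (ℚP.*-identityʳ (ℚnat m))) ⟩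
  1ℚ ℚ.* (fromℤ (+ suc m) ℚ.- fromℤ (+ m))         ≡⟨ ℚP.*-identityˡ _ ⟩
  fromℤ (+ suc m) ℚ.+ ℚ.- fromℤ (+ m)              ≡⟨ cong (fromℤ (+ suc m) ℚ.+_) (fromℤ-neg (+ m)) ⟨
  fromℤ (+ suc m) ℚ.+ fromℤ (ℤ.- + m)              ≡⟨ fromℤ-+ (+ suc m) (ℤ.- + m) ⟨
  fromℤ (+ suc m ℤ.- + m)                          ≡⟨ cong fromℤ (1+M-M≡1 (+ m)) ⟩
  1ℚ                                               ∎
  where
  open ≡-Reasoning
  1+M-M≡1 : ∀ M → (1ℤ ℤ.+ M) ℤ.- M ≡ 1ℤ
  1+M-M≡1 = solve-∀

fpoly-d/d-1 : ∀ m → fpoly (suc (suc m)) (d/d-1 (suc (suc m))) ≡ 0ℚ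
fpoly-d/d-1 m = begin
  fpoly (suc (suc m)) y                  ≡⟨ fpoly-factored (suc m) y ⟩
  (y ^ℚ suc m) ℚ.* (D ℚ.- M ℚ.* y)       ≡⟨ cong (λ u → (y ^ℚ suc m) ℚ.* (D ℚ.- u)) (trans (ℚP.*-comm M y) (/-*-fromℤ (+ suc (suc m)) m)) ⟩
  (y ^ℚ suc m) ℚ.* (D ℚ.- D)             ≡⟨ cong ((y ^ℚ suc m) ℚ.*_) (ℚP.+-inverseʳ D) ⟩
  (y ^ℚ suc m) ℚ.* 0ℚ                    ≡⟨ ℚP.*-zeroʳ (y ^ℚ suc m) ⟩
  0ℚ                                     ∎
  where
  open ≡-Reasoning
  y = d/d-1 (suc (suc m))
  D = ℚnat (suc (suc m))
  M = ℚnat (suc m)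

fromℤ-≢0 : ∀ {i} → i ≢ 0ℤ → fromℤ i ≢ 0ℚ
fromℤ-≢0 i≢0 fromℤi≡0 = i≢0 (fromℤ-injective fromℤi≡0)

d/d-1≢0 : ∀ m → d/d-1 (suc (suc m)) ≢ 0ℚ
d/d-1≢0 m y≡0 = fromℤ-≢0 {+ suc (suc m)} (λ ()) (begin
  fromℤ (+ suc (suc m))                     ≡⟨ /-*-fromℤ (+ suc (suc m)) m ⟨
  d/d-1 (suc (suc m)) ℚ.* fromℤ (+ suc m)   ≡⟨ cong (ℚ._* fromℤ (+ suc m)) y≡0 ⟩
  0ℚ ℚ.* fromℤ (+ suc m)                    ≡⟨ ℚP.*-zeroˡ (fromℤ (+ suc m)) ⟩
  0ℚ                                        ∎)
  where open ≡-Reasoning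

-- Indexed by m = d - 1:  f (p / q) = fnum m p q / q ^ d.
cofactor : ℕ → ℤ → ℤ → ℤ
cofactor m p q = + suc m ℤ.* q ℤ.- + m ℤ.* p

fnum : ℕ → ℤ → ℤ → ℤ
fnum m p q = p ℤ.^ m ℤ.* cofactor m p q

fromℤ-cofactor : ∀ m p q →
  fromℤ (cofactor m p q) ≡ fromℤ (+ suc m) ℚ.* fromℤ q ℚ.+ ℚ.- (fromℤ (+ m) ℚ.* fromℤ p)
fromℤ-cofactor m p q = begin
  fromℤ (+ suc m ℤ.* q ℤ.- + m ℤ.* p)                     ≡⟨ fromℤ-+ (+ suc m ℤ.* q) (ℤ.- (+ m ℤ.* p)) ⟩
  fromℤ (+ suc m ℤ.* q) ℚ.+ fromℤ (ℤ.- (+ m ℤ.* p))       ≡⟨ cong₂ ℚ._+_ (fromℤ-* (+ suc m) q) (fromℤ-neg (+ m ℤ.* p)) ⟩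
  fromℤ (+ suc m) ℚ.* fromℤ q ℚ.+ ℚ.- fromℤ (+ m ℤ.* p)   ≡⟨ cong (λ u → fromℤ (+ suc m) ℚ.* fromℤ q ℚ.+ ℚ.- u) (fromℤ-* (+ m) p) ⟩
  fromℤ (+ suc m) ℚ.* fromℤ q ℚ.+ ℚ.- (fromℤ (+ m) ℚ.* fromℤ p) ∎
  where open ≡-Reasoning

fpoly-cleared : ∀ m x → fpoly (suc m) x ℚ.* fromℤ (↧ x ℤ.^ suc m) ≡ fromℤ (fnum m (↥ x) (↧ x))
fpoly-cleared m x = sym (begin
  fromℤ (fnum m p q)
    ≡⟨ fromℤ-* (p ℤ.^ m) (cofactor m p q) ⟩
  fromℤ (p ℤ.^ m) ℚ.* fromℤ (cofactor m p q)
    ≡⟨ cong₂ ℚ._*_ (fromℤ-^ p m) (fromℤ-cofactor m p q) ⟩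
  (fromℤ p ^ℚ m) ℚ.* (D ℚ.* q′ ℚ.+ ℚ.- (M ℚ.* fromℤ p))
    ≡⟨ cong (λ y → (y ^ℚ m) ℚ.* (D ℚ.* q′ ℚ.+ ℚ.- (M ℚ.* y))) (sym (*-↧≡↥ x)) ⟩
  ((x ℚ.* q′) ^ℚ m) ℚ.* (D ℚ.* q′ ℚ.+ ℚ.- (M ℚ.* (x ℚ.* q′)))
    ≡⟨ cong (ℚ._* (D ℚ.* q′ ℚ.+ ℚ.- (M ℚ.* (x ℚ.* q′)))) (^ℚ-distribʳ-* x q′ m) ⟩
  ((x ^ℚ m) ℚ.* (q′ ^ℚ m)) ℚ.* (D ℚ.* q′ ℚ.+ ℚ.- (M ℚ.* (x ℚ.* q′)))
    ≡⟨ solveℚ 6 (λ X Y D M q x → (X :* Y) :* (D :* q :+ :- (M :* (x :* q))) := ((:- M) :* (x :* X) :+ D :* X) :* (q :* Y))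
         refl (x ^ℚ m) (q′ ^ℚ m) D M q′ x ⟩
  fpoly (suc m) x ℚ.* (q′ ^ℚ suc m)
    ≡⟨ cong (fpoly (suc m) x ℚ.*_) (sym (fromℤ-^ q (suc m))) ⟩
  fpoly (suc m) x ℚ.* fromℤ (q ℤ.^ suc m) ∎)
  where
  open ≡-Reasoning
  open ℚSolver.+-*-Solver using (_:+_; _:*_; :-_; _:=_) renaming (solve to solveℚ)
  p = ↥ x
  q = ↧ x
  q′ = fromℤ q
  D = fromℤ (+ suc m)
  M = fromℤ (+ m)

fpoly≡⇒cleared : ∀ m x {c} A B → c ℚ.* fromℤ B ≡ fromℤ A → fpoly (suc m) x ≡ c →
  B ℤ.* fnum m (↥ x) (↧ x) ≡ A ℤ.* ↧ x ℤ.^ suc m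
fpoly≡⇒cleared m x {c} A B c*B≡A fx≡c = fromℤ-injective (begin
  fromℤ (B ℤ.* fnum m (↥ x) (↧ x))        ≡⟨ fromℤ-* B _ ⟩
  fromℤ B ℚ.* fromℤ (fnum m (↥ x) (↧ x))  ≡⟨ cong (fromℤ B ℚ.*_) (fpoly-cleared m x) ⟨
  fromℤ B ℚ.* (fpoly (suc m) x ℚ.* qᵈ)     ≡⟨ cong (λ u → fromℤ B ℚ.* (u ℚ.* qᵈ)) fx≡c ⟩
  fromℤ B ℚ.* (c ℚ.* qᵈ)                   ≡⟨ ℚP.*-assoc (fromℤ B) c qᵈ ⟨
  (fromℤ B ℚ.* c) ℚ.* qᵈ                   ≡⟨ cong (ℚ._* qᵈ) (trans (ℚP.*-comm (fromℤ B) c) c*B≡A) ⟩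
  fromℤ A ℚ.* qᵈ                           ≡⟨ fromℤ-* A (↧ x ℤ.^ suc m) ⟨
  fromℤ (A ℤ.* ↧ x ℤ.^ suc m)              ∎)
  where
  open ≡-Reasoning
  qᵈ = fromℤ (↧ x ℤ.^ suc m)

cleared-rearranged : ∀ m p q A B → B ℤ.* fnum m p q ≡ A ℤ.* q ℤ.^ suc m →
  B ℤ.* + m ℤ.* p ℤ.^ suc m ≡ q ℤ.* (B ℤ.* + suc m ℤ.* p ℤ.^ m ℤ.- A ℤ.* q ℤ.^ m)
cleared-rearranged m p q A B eq = begin
  B ℤ.* + m ℤ.* (p ℤ.* p ℤ.^ m)                                 ≡⟨ expand B (+ m) p q (p ℤ.^ m) ⟩
  q ℤ.* (B ℤ.* + suc m ℤ.* p ℤ.^ m) ℤ.- B ℤ.* fnum m p q        ≡⟨ cong (λ u → q ℤ.* (B ℤ.* + suc m ℤ.* p ℤ.^ m) ℤ.- u) eq ⟩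
  q ℤ.* (B ℤ.* + suc m ℤ.* p ℤ.^ m) ℤ.- A ℤ.* (q ℤ.* q ℤ.^ m)  ≡⟨ collect q (B ℤ.* + suc m ℤ.* p ℤ.^ m) A (q ℤ.^ m) ⟩
  q ℤ.* (B ℤ.* + suc m ℤ.* p ℤ.^ m ℤ.- A ℤ.* q ℤ.^ m)          ∎
  where
  open ≡-Reasoning
  expand : ∀ B M p q pᵐ → B ℤ.* M ℤ.* (p ℤ.* pᵐ)
         ≡ q ℤ.* (B ℤ.* (1ℤ ℤ.+ M) ℤ.* pᵐ) ℤ.- B ℤ.* (pᵐ ℤ.* ((1ℤ ℤ.+ M) ℤ.* q ℤ.- M ℤ.* p))
  expand = solve-∀
  collect : ∀ q X A qᵐ → q ℤ.* X ℤ.- A ℤ.* (q ℤ.* qᵐ) ≡ q ℤ.* (X ℤ.- A ℤ.* qᵐ)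
  collect = solve-∀

pos-^ : ∀ n k → (+ n) ℤ.^ k ≡ + (n ^ k)
pos-^ n zero    = refl
pos-^ n (suc k) = trans (cong ((+ n) ℤ.*_) (pos-^ n k)) (sym (ℤP.pos-* n (n ^ k)))

abs-^ : ∀ i k → ∣ i ℤ.^ k ∣ ≡ ∣ i ∣ ^ k
abs-^ i zero    = refl
abs-^ i (suc k) = trans (ℤP.abs-* i (i ℤ.^ k)) (cong (∣ i ∣ *_) (abs-^ i k))

∣i∣≡1⇒i≡±1 : ∀ {i} → ∣ i ∣ ≡ 1 → i ≡ 1ℤ ⊎ i ≡ -1ℤ
∣i∣≡1⇒i≡±1 {+ .1}       refl = inj₁ refl
∣i∣≡1⇒i≡±1 { -[1+ .0 ]} refl = inj₂ refl

coprime-^ʳ : ∀ {a b} k → Coprime a b → Coprime a (b ^ k)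
coprime-^ʳ zero    _   (_ , d∣1)     = ∣1⇒≡1 d∣1
coprime-^ʳ (suc k) a⊥b (d∣a , d∣bbᵏ) = coprime-^ʳ k a⊥b (d∣a , coprime-divisor d⊥b d∣bbᵏ)
  where
  d⊥b : Coprime _ _
  d⊥b (e∣d , e∣b) = a⊥b (∣-trans e∣d d∣a , e∣b)

coprime-^ : ∀ {a b} j k → Coprime a b → Coprime (a ^ j) (b ^ k)
coprime-^ j k a⊥b = Coprime.sym (coprime-^ʳ j (Coprime.sym (coprime-^ʳ k a⊥b)))

↥-↧-coprime : ∀ x → Coprime ∣ ↥ x ∣ (↧ₙ x)
↥-↧-coprime (mkℚ _ _ c) = Coprime.recompute c

≡-from-↥↧ₙ : ∀ {x y} → ↥ x ≡ ↥ y → ↧ₙ x ≡ ↧ₙ y → x ≡ y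
≡-from-↥↧ₙ {mkℚ _ _ _} {mkℚ _ _ _} refl refl = refl

↥-power-∣ : ∀ x e j c A → ↥ x ℤ.^ e ℤ.* c ≡ A ℤ.* ↧ x ℤ.^ j → ∣ ↥ x ∣ ^ e ∣ ∣ A ∣
↥-power-∣ x e j c A eq = coprime-divisor (coprime-^ e j (↥-↧-coprime x)) (divides ∣ c ∣ (begin
  ↧ₙ x ^ j * ∣ A ∣          ≡⟨ *-comm (↧ₙ x ^ j) ∣ A ∣ ⟩
  ∣ A ∣ * ↧ₙ x ^ j          ≡⟨ cong (∣ A ∣ *_) (abs-^ (↧ x) j) ⟨
  ∣ A ∣ * ∣ ↧ x ℤ.^ j ∣     ≡⟨ ℤP.abs-* A (↧ x ℤ.^ j) ⟨
  ∣ A ℤ.* ↧ x ℤ.^ j ∣       ≡⟨ cong ∣_∣ eq ⟨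
  ∣ ↥ x ℤ.^ e ℤ.* c ∣       ≡⟨ ℤP.abs-* (↥ x ℤ.^ e) c ⟩
  ∣ ↥ x ℤ.^ e ∣ * ∣ c ∣     ≡⟨ cong (_* ∣ c ∣) (abs-^ (↥ x) e) ⟩
  ∣ ↥ x ∣ ^ e * ∣ c ∣       ≡⟨ *-comm (∣ ↥ x ∣ ^ e) ∣ c ∣ ⟩
  ∣ c ∣ * ∣ ↥ x ∣ ^ e       ∎))
  where open ≡-Reasoning

↥≡±1 : ∀ x e j c A → ∣ A ∣ ≡ 1 → ↥ x ℤ.^ suc e ℤ.* c ≡ A ℤ.* ↧ x ℤ.^ j → ↥ x ≡ 1ℤ ⊎ ↥ x ≡ -1ℤ
↥≡±1 x e j c A ∣A∣≡1 eq
  with m^n≡1⇒n≡0∨m≡1 ∣ ↥ x ∣ (suc e) (∣1⇒≡1 (subst (_ ∣_) ∣A∣≡1 (↥-power-∣ x (suc e) j c A eq)))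
... | inj₂ ∣↥x∣≡1 = ∣i∣≡1⇒i≡±1 ∣↥x∣≡1

↧ₙ-∣ : ∀ m x A B → B ℤ.* fnum m (↥ x) (↧ x) ≡ A ℤ.* ↧ x ℤ.^ suc m → ↧ₙ x ∣ ∣ B ∣ * m * ∣ ↥ x ∣ ^ suc m
↧ₙ-∣ m x A B eq = divides ∣ r ∣ (begin
  ∣ B ∣ * m * ∣ ↥ x ∣ ^ suc m          ≡⟨ cong₂ _*_ (ℤP.abs-* B (+ m)) (abs-^ (↥ x) (suc m)) ⟨
  ∣ B ℤ.* + m ∣ * ∣ ↥ x ℤ.^ suc m ∣    ≡⟨ ℤP.abs-* (B ℤ.* + m) (↥ x ℤ.^ suc m) ⟨
  ∣ B ℤ.* + m ℤ.* ↥ x ℤ.^ suc m ∣      ≡⟨ cong ∣_∣ (cleared-rearranged m (↥ x) (↧ x) A B eq) ⟩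
  ∣ ↧ x ℤ.* r ∣                        ≡⟨ ℤP.abs-* (↧ x) r ⟩
  ↧ₙ x * ∣ r ∣                         ≡⟨ *-comm (↧ₙ x) ∣ r ∣ ⟩
  ∣ r ∣ * ↧ₙ x                         ∎)
  where
  open ≡-Reasoning
  r = B ℤ.* + suc m ℤ.* ↥ x ℤ.^ m ℤ.- A ℤ.* ↧ x ℤ.^ m

cofactor-at-1 : ∀ m e n → 1ℤ ℤ.^ e ℤ.* cofactor m 1ℤ (+ n) ℤ.+ + m ≡ + (suc m * n)
cofactor-at-1 m e n = begin
  1ℤ ℤ.^ e ℤ.* cofactor m 1ℤ (+ n) ℤ.+ + m  ≡⟨ cong (λ u → u ℤ.* cofactor m 1ℤ (+ n) ℤ.+ + m) (ℤP.^-zeroˡ e) ⟩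
  1ℤ ℤ.* cofactor m 1ℤ (+ n) ℤ.+ + m        ≡⟨ simplify (+ m) (+ n) ⟩
  + suc m ℤ.* + n                           ≡⟨ ℤP.pos-* (suc m) n ⟨
  + (suc m * n)                             ∎
  where
  open ≡-Reasoning
  simplify : ∀ M N → 1ℤ ℤ.* ((1ℤ ℤ.+ M) ℤ.* N ℤ.- M ℤ.* 1ℤ) ℤ.+ M ≡ (1ℤ ℤ.+ M) ℤ.* N
  simplify = solve-∀

∣cofactor-at--1∣ : ∀ m e n → ∣ -1ℤ ℤ.^ e ℤ.* cofactor m -1ℤ (+ n) ∣ ≡ suc m * n + m
∣cofactor-at--1∣ m e n = begin
  ∣ -1ℤ ℤ.^ e ℤ.* cofactor m -1ℤ (+ n) ∣      ≡⟨ ℤP.abs-* (-1ℤ ℤ.^ e) _ ⟩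
  ∣ -1ℤ ℤ.^ e ∣ * ∣ cofactor m -1ℤ (+ n) ∣    ≡⟨ cong₂ _*_ (trans (abs-^ -1ℤ e) (^-zeroˡ e)) (cong ∣_∣ (simplify (+ m) (+ n))) ⟩
  1 * ∣ (1ℤ ℤ.+ + m) ℤ.* + n ℤ.+ + m ∣        ≡⟨ *-identityˡ _ ⟩
  ∣ + suc m ℤ.* + n ℤ.+ + m ∣                 ≡⟨ cong (λ u → ∣ u ℤ.+ + m ∣) (ℤP.pos-* (suc m) n) ⟨
  suc m * n + m                               ∎
  where
  open ≡-Reasoning
  simplify : ∀ M N → (1ℤ ℤ.+ M) ℤ.* N ℤ.- M ℤ.* -1ℤ ≡ (1ℤ ℤ.+ M) ℤ.* N ℤ.+ M
  simplify = solve-∀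

cleared-at-±1 : ∀ m e {p} n j → p ≡ 1ℤ ⊎ p ≡ -1ℤ → p ℤ.^ e ℤ.* cofactor m p (+ n) ≡ (+ n) ℤ.^ j →
  (p ≡ 1ℤ × suc m * n ≡ n ^ j + m) ⊎ (p ≡ -1ℤ × suc m * n + m ≡ n ^ j)
cleared-at-±1 m e n j (inj₁ refl) eq = inj₁ (refl , ℤP.+-injective (begin
  + (suc m * n)                              ≡⟨ cofactor-at-1 m e n ⟨
  1ℤ ℤ.^ e ℤ.* cofactor m 1ℤ (+ n) ℤ.+ + m   ≡⟨ cong (ℤ._+ + m) (trans eq (pos-^ n j)) ⟩
  + (n ^ j + m)                              ∎))
  where open ≡-Reasoning
cleared-at-±1 m e n j (inj₂ refl) eq =
  inj₂ (refl , trans (sym (∣cofactor-at--1∣ m e n)) (cong ∣_∣ (trans eq (pos-^ n j))))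

1+m*r≤[1+r]^m : ∀ r m → 1 + m * r ≤ suc r ^ m
1+m*r≤[1+r]^m r zero    = ≤-refl
1+m*r≤[1+r]^m r (suc m) = begin
  1 + suc m * r              ≤⟨ m≤m+n (1 + suc m * r) (m * r * r) ⟩
  1 + suc m * r + m * r * r  ≡⟨ solve (r ∷ m ∷ []) ⟩
  suc r * (1 + m * r)        ≤⟨ *-monoʳ-≤ (suc r) (1+m*r≤[1+r]^m r m) ⟩
  suc r * suc r ^ m          ∎
  where open ≤-Reasoning

n*m≤n^m : ∀ {n} m → 2 ≤ n → n * m ≤ n ^ m
n*m≤n^m {n} zero _ = ≤-trans (≤-reflexive (*-zeroʳ n)) z≤n
n*m≤n^m {n@(suc (suc r))} (suc m) (s≤s (s≤s z≤n)) = *-monoʳ-≤ n (begin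
  suc m              ≤⟨ s≤s (m≤m*n m (suc r)) ⟩
  1 + m * suc r      ≤⟨ 1+m*r≤[1+r]^m (suc r) m ⟩
  n ^ m              ∎)
  where open ≤-Reasoning

[1+m]n≡nᵐ+m⇒n≡1∨m≡n≡2 : ∀ {m n} → 2 ≤ m → 1 ≤ n → suc m * n ≡ n ^ m + m → n ≡ 1 ⊎ (m ≡ 2 × n ≡ 2)
[1+m]n≡nᵐ+m⇒n≡1∨m≡n≡2 {n = 1} _ _ _ = inj₁ refl
[1+m]n≡nᵐ+m⇒n≡1∨m≡n≡2 {2} {2} _ _ _ = inj₂ (refl , refl)
[1+m]n≡nᵐ+m⇒n≡1∨m≡n≡2 {m@(suc (suc (suc j)))} {2} _ _ eq = ⊥-elim (<⇒≢ lt eq)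
  where
  open ≤-Reasoning
  lt : suc m * 2 < 2 ^ m + m
  lt = begin-strict
    suc m * 2          <⟨ m<m+n (suc m * 2) (s≤s z≤n) ⟩
    suc m * 2 + suc j  ≡⟨ solve (j ∷ []) ⟩
    2 * m + m          ≤⟨ +-monoˡ-≤ m (n*m≤n^m m (s≤s (s≤s z≤n))) ⟩
    2 ^ m + m          ∎
[1+m]n≡nᵐ+m⇒n≡1∨m≡n≡2 {m@(suc (suc k))} {n@(suc (suc (suc r)))} _ _ eq =
  ⊥-elim (<⇒≢ (≤-<-trans bound (m<m+n (n ^ m) (s≤s z≤n))) eq)
  where
  open ≤-Reasoning
  bound : suc m * n ≤ n ^ m
  bound = begin
    suc m * n                                 ≤⟨ *-monoˡ-≤ n (m≤m+n (3 + k) (2 * k + r * suc k)) ⟩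
    (3 + k + (2 * k + r * suc k)) * (3 + r)   ≡⟨ solve (r ∷ k ∷ []) ⟩
    (3 + r) * ((3 + r) * suc k)               ≤⟨ *-monoʳ-≤ n (n*m≤n^m (suc k) (s≤s (s≤s z≤n))) ⟩
    n ^ m                                     ∎
[1+m]n≡nᵐ+m⇒n≡1∨m≡n≡2 {1} (s≤s ()) _ _
[1+m]n≡nᵐ+m⇒n≡1∨m≡n≡2 {zero} () _ _
[1+m]n≡nᵐ+m⇒n≡1∨m≡n≡2 {n = zero} _ () _

[1+m]n≡nᵐ⁺¹+m⇒n≡1 : ∀ {m n} → 1 ≤ m → 1 ≤ n → suc m * n ≡ n ^ suc m + m → n ≡ 1
[1+m]n≡nᵐ⁺¹+m⇒n≡1 {n = 1} _ _ _ = refl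
[1+m]n≡nᵐ⁺¹+m⇒n≡1 {m@(suc _)} {n@(suc (suc _))} _ _ eq =
  ⊥-elim (<⇒≢ (≤-<-trans bound (m<m+n (n ^ suc m) (s≤s z≤n))) eq)
  where
  bound : suc m * n ≤ n ^ suc m
  bound = ≤-trans (≤-reflexive (*-comm (suc m) n)) (n*m≤n^m (suc m) (s≤s (s≤s z≤n)))
[1+m]n≡nᵐ⁺¹+m⇒n≡1 {n = zero} _ () _

[1+m]n+m≡nᵐ⁺¹⇒m≡n≡2 : ∀ {m n} → 2 ≤ m → 1 ≤ n → suc m * n + m ≡ n ^ suc m → m ≡ 2 × n ≡ 2
[1+m]n+m≡nᵐ⁺¹⇒m≡n≡2 {m} {1} (s≤s (s≤s _)) _ eq with trans eq (^-zeroˡ (suc m))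
... | ()
[1+m]n+m≡nᵐ⁺¹⇒m≡n≡2 {2} {2} _ _ _ = refl , refl
[1+m]n+m≡nᵐ⁺¹⇒m≡n≡2 {m@(suc (suc (suc j)))} {2} _ _ eq = ⊥-elim (<⇒≢ lt eq)
  where
  open ≤-Reasoning
  lt : suc m * 2 + m < 2 ^ suc m
  lt = begin-strict
    suc m * 2 + m          <⟨ m<m+n (suc m * 2 + m) (s≤s z≤n) ⟩
    suc m * 2 + m + suc j  ≡⟨ solve (j ∷ []) ⟩
    2 * (2 * m)            ≤⟨ *-monoʳ-≤ 2 (n*m≤n^m m (s≤s (s≤s z≤n))) ⟩
    2 ^ suc m              ∎
[1+m]n+m≡nᵐ⁺¹⇒m≡n≡2 {m@(suc (suc k))} {n@(suc (suc (suc r)))} _ _ eq = ⊥-elim (<⇒≢ lt eq)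
  where
  open ≤-Reasoning
  lt : suc m * n + m < n ^ suc m
  lt = begin-strict
    suc m * n + m               <⟨ +-monoʳ-< (suc m * n) (<-≤-trans (n<1+n m) (m≤m*n (suc m) n)) ⟩
    suc m * n + suc m * n       ≤⟨ ≤-reflexive (solve (k ∷ r ∷ [])) ⟩
    (6 + 2 * k) * (3 + r)       ≤⟨ *-monoˡ-≤ n (m≤m+n (6 + 2 * k) (k + 2 * r + r * k)) ⟩
    (6 + 2 * k + (k + 2 * r + r * k)) * (3 + r) ≡⟨ solve (k ∷ r ∷ []) ⟩
    (3 + r) * ((3 + r) * (2 + k)) ≤⟨ *-monoʳ-≤ n (n*m≤n^m m (s≤s (s≤s z≤n))) ⟩
    n ^ suc m                   ∎
[1+m]n+m≡nᵐ⁺¹⇒m≡n≡2 {n = zero} _ () _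
[1+m]n+m≡nᵐ⁺¹⇒m≡n≡2 {1} (s≤s ()) _ _

[1+m]n+m≢nᵐ : ∀ {m n} → 2 ≤ m → 1 ≤ n → suc m * n + m ≢ n ^ m
[1+m]n+m≢nᵐ {m@(suc (suc _))} {1} _ _ eq with trans eq (^-zeroˡ m)
... | ()
[1+m]n+m≢nᵐ {2} {2} _ _ ()
[1+m]n+m≢nᵐ {3} {2} _ _ ()
[1+m]n+m≢nᵐ {4} {2} _ _ ()
[1+m]n+m≢nᵐ {m@(suc (suc (suc (suc (suc j)))))} {2} _ _ = <⇒≢ (begin-strict
  suc m * 2 + m                <⟨ m<m+n (suc m * 2 + m) (s≤s z≤n) ⟩
  suc m * 2 + m + suc (6 + 5 * j) ≡⟨ solve (j ∷ []) ⟩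
  2 * (2 * (2 * (3 + j)))      ≤⟨ *-monoʳ-≤ 2 (*-monoʳ-≤ 2 (n*m≤n^m (3 + j) (s≤s (s≤s z≤n)))) ⟩
  2 ^ m                        ∎)
  where open ≤-Reasoning
[1+m]n+m≢nᵐ {2} {3} _ _ ()
[1+m]n+m≢nᵐ {m@(suc (suc (suc j)))} {3} _ _ = <⇒≢ (begin-strict
  suc m * 3 + m                <⟨ m<m+n (suc m * 3 + m) (s≤s z≤n) ⟩
  suc m * 3 + m + suc (2 + 5 * j) ≡⟨ solve (j ∷ []) ⟩
  3 * (3 * (2 + j))            ≤⟨ *-monoʳ-≤ 3 (n*m≤n^m (2 + j) (s≤s (s≤s z≤n))) ⟩
  3 ^ m                        ∎)
  where open ≤-Reasoning
[1+m]n+m≢nᵐ {m@(suc (suc k))} {n@(suc (suc (suc (suc r))))} _ _ = <⇒≢ (begin-strict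
  suc m * n + m                <⟨ +-monoʳ-< (suc m * n) (begin-strict
     2 + k                       <⟨ m<m+n (2 + k) (s≤s z≤n) ⟩
     2 + k + (2 + 11 * k)        ≡⟨ solve (k ∷ []) ⟩
     4 * (1 + 3 * k)             ≤⟨ *-mono-≤ (m≤m+n 4 r) (m≤m+n (1 + 3 * k) (r + r * k)) ⟩
     n * (1 + 3 * k + (r + r * k)) ∎) ⟩
  suc m * n + n * (1 + 3 * k + (r + r * k)) ≡⟨ solve (k ∷ r ∷ []) ⟩
  (4 + r) * ((4 + r) * (1 + k)) ≤⟨ *-monoʳ-≤ n (n*m≤n^m (1 + k) (s≤s (s≤s z≤n))) ⟩
  n ^ m                        ∎)
  where open ≤-Reasoning
[1+m]n+m≢nᵐ {n = zero} _ ()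
[1+m]n+m≢nᵐ {1} (s≤s ()) _

aᵐ≤1+m⇒a≤1 : ∀ {m a} → 2 ≤ m → a ^ m ≤ suc m → a ≤ 1
aᵐ≤1+m⇒a≤1 {a = 0} _ _ = z≤n
aᵐ≤1+m⇒a≤1 {a = 1} _ _ = ≤-refl
aᵐ≤1+m⇒a≤1 {m@(suc (suc k))} {a@(suc (suc r))} _ le = ⊥-elim (<⇒≱ (begin-strict
  suc m        <⟨ m<m+n (suc m) (s≤s z≤n) ⟩
  suc m + suc k ≡⟨ solve (k ∷ []) ⟩
  2 * m        ≤⟨ *-monoˡ-≤ m (m≤m+n 2 r) ⟩
  a * m        ≤⟨ n*m≤n^m m (s≤s (s≤s z≤n)) ⟩
  a ^ m        ∎) le)
  where open ≤-Reasoning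
aᵐ≤1+m⇒a≤1 {1} (s≤s ()) _

fixed-point-equation : ∀ m x → ↥ x ≢ 0ℤ → fpoly (suc (suc m)) x ≡ x →
  ↥ x ℤ.^ m ℤ.* cofactor (suc m) (↥ x) (↧ x) ≡ ↧ x ℤ.^ suc m
fixed-point-equation m x ↥x≢0 fx≡x = ℤP.*-cancelˡ-≡ (p ℤ.* q) _ _ {{pq≢0}} (begin
  p ℤ.* q ℤ.* (p ℤ.^ m ℤ.* c)       ≡⟨ shuffle p q (p ℤ.^ m) c ⟩
  q ℤ.* fnum (suc m) p q             ≡⟨ fpoly≡⇒cleared (suc m) x p q (*-↧≡↥ x) fx≡x ⟩
  p ℤ.* q ℤ.^ suc (suc m)            ≡⟨ ℤP.*-assoc p q (q ℤ.^ suc m) ⟨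
  p ℤ.* q ℤ.* q ℤ.^ suc m            ∎)
  where
  open ≡-Reasoning
  p = ↥ x
  q = ↧ x
  c = cofactor (suc m) p q
  pq≢0 : ℤ.NonZero (p ℤ.* q)
  pq≢0 = ℤP.i*j≢0 p q {{ℤ.≢-nonZero ↥x≢0}}
  shuffle : ∀ p q pᵐ c → p ℤ.* q ℤ.* (pᵐ ℤ.* c) ≡ q ℤ.* (p ℤ.* pᵐ ℤ.* c)
  shuffle = solve-∀

fixed-points : ∀ {m} x → 2 ≤ m → fpoly (suc m) x ≡ x → x ≡ 0ℚ ⊎ x ≡ 1ℚ ⊎ (m ≡ 2 × x ≡ ½)
fixed-points {m@(suc (suc k))} x m≥2 fx≡x with ↥ x ℤ.≟ 0ℤ
... | yes ↥x≡0 = inj₁ (ℚP.↥p≡0⇒p≡0 x ↥x≡0)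
... | no ↥x≢0  = conclude (cleared-at-±1 m (suc k) (↧ₙ x) m ↥x≡±1 eq)
  where
  c = cofactor m (↥ x) (↧ x)
  eq = fixed-point-equation (suc k) x ↥x≢0 fx≡x
  ↥x≡±1 = ↥≡±1 x k m c 1ℤ refl (trans eq (sym (ℤP.*-identityˡ _)))
  conclude : (↥ x ≡ 1ℤ × suc m * ↧ₙ x ≡ ↧ₙ x ^ m + m) ⊎ (↥ x ≡ -1ℤ × suc m * ↧ₙ x + m ≡ ↧ₙ x ^ m) →
             x ≡ 0ℚ ⊎ x ≡ 1ℚ ⊎ (m ≡ 2 × x ≡ ½)
  conclude (inj₂ (_ , eq′)) = ⊥-elim ([1+m]n+m≢nᵐ m≥2 (s≤s z≤n) eq′)
  conclude (inj₁ (↥x≡1 , eq′)) with [1+m]n≡nᵐ+m⇒n≡1∨m≡n≡2 m≥2 (s≤s z≤n) eq′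
  ... | inj₁ ↧x≡1         = inj₂ (inj₁ (≡-from-↥↧ₙ ↥x≡1 ↧x≡1))
  ... | inj₂ (m≡2 , ↧x≡2) = inj₂ (inj₂ (m≡2 , ≡-from-↥↧ₙ ↥x≡1 ↧x≡2))
fixed-points {1} _ (s≤s ()) _

preimages-of-1 : ∀ {m} x → 2 ≤ m → fpoly (suc m) x ≡ 1ℚ → x ≡ 1ℚ ⊎ (m ≡ 2 × x ≡ -½)
preimages-of-1 {m@(suc (suc k))} x m≥2 fx≡1 =
  conclude (cleared-at-±1 m m (↧ₙ x) (suc m) ↥x≡±1 eq)
  where
  c = cofactor m (↥ x) (↧ x)
  eq : fnum m (↥ x) (↧ x) ≡ ↧ x ℤ.^ suc m
  eq = trans (sym (ℤP.*-identityˡ _)) (trans (fpoly≡⇒cleared m x 1ℤ 1ℤ refl fx≡1) (ℤP.*-identityˡ _))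
  ↥x≡±1 = ↥≡±1 x (suc k) (suc m) c 1ℤ refl (trans eq (sym (ℤP.*-identityˡ _)))
  conclude : (↥ x ≡ 1ℤ × suc m * ↧ₙ x ≡ ↧ₙ x ^ suc m + m) ⊎ (↥ x ≡ -1ℤ × suc m * ↧ₙ x + m ≡ ↧ₙ x ^ suc m) →
             x ≡ 1ℚ ⊎ (m ≡ 2 × x ≡ -½)
  conclude (inj₁ (↥x≡1 , eq′)) = inj₁ (≡-from-↥↧ₙ ↥x≡1 ([1+m]n≡nᵐ⁺¹+m⇒n≡1 (s≤s z≤n) (s≤s z≤n) eq′))
  conclude (inj₂ (↥x≡-1 , eq′)) with [1+m]n+m≡nᵐ⁺¹⇒m≡n≡2 m≥2 (s≤s z≤n) eq′
  ... | m≡2 , ↧x≡2 = inj₂ (m≡2 , ≡-from-↥↧ₙ ↥x≡-1 ↧x≡2)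
preimages-of-1 {1} _ (s≤s ()) _

cofactor≡0⇒≡d/d-1 : ∀ m x → cofactor (suc m) (↥ x) (↧ x) ≡ 0ℤ → x ≡ d/d-1 (suc (suc m))
cofactor≡0⇒≡d/d-1 m x c≡0 = ℚ-*-cancelʳ-≡ x y (q ℚ.* M) qM≢0 (begin
  x ℚ.* (q ℚ.* M)                ≡⟨ ℚP.*-assoc x q M ⟨
  (x ℚ.* q) ℚ.* M                ≡⟨ cong (ℚ._* M) (*-↧≡↥ x) ⟩
  fromℤ (↥ x) ℚ.* M              ≡⟨ ℚP.*-comm (fromℤ (↥ x)) M ⟩
  M ℚ.* fromℤ (↥ x)              ≡⟨ fromℤ-* (+ suc m) (↥ x) ⟨
  fromℤ (+ suc m ℤ.* ↥ x)        ≡⟨ cong fromℤ (ℤP.i-j≡0⇒i≡j (+ suc (suc m) ℤ.* ↧ x) (+ suc m ℤ.* ↥ x) c≡0) ⟨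
  fromℤ (+ suc (suc m) ℤ.* ↧ x)  ≡⟨ fromℤ-* (+ suc (suc m)) (↧ x) ⟩
  D ℚ.* q                        ≡⟨ cong (ℚ._* q) (/-*-fromℤ (+ suc (suc m)) m) ⟨
  (y ℚ.* M) ℚ.* q                ≡⟨ ℚP.*-assoc y M q ⟩
  y ℚ.* (M ℚ.* q)                ≡⟨ cong (y ℚ.*_) (ℚP.*-comm M q) ⟩
  y ℚ.* (q ℚ.* M)                ∎)
  where
  open ≡-Reasoning
  y = d/d-1 (suc (suc m))
  q = fromℤ (↧ x)
  D = fromℤ (+ suc (suc m))
  M = fromℤ (+ suc m)
  qM≢0 : q ℚ.* M ≢ 0ℚ
  qM≢0 qM≡0 = fromℤ-≢0 {↧ x ℤ.* + suc m} (λ ()) (trans (fromℤ-* (↧ x) (+ suc m)) qM≡0)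

preimages-of-0 : ∀ {m} x → 1 ≤ m → fpoly (suc m) x ≡ 0ℚ → x ≡ 0ℚ ⊎ x ≡ d/d-1 (suc m)
preimages-of-0 {m@(suc k)} x _ fx≡0 = conclude (ℤP.i*j≡0⇒i≡0∨j≡0 (↥ x ℤ.^ m) eq)
  where
  eq : fnum m (↥ x) (↧ x) ≡ 0ℤ
  eq = trans (sym (ℤP.*-identityˡ _)) (trans (fpoly≡⇒cleared m x 0ℤ 1ℤ refl fx≡0) (ℤP.*-zeroˡ (↧ x ℤ.^ suc m)))
  conclude : ↥ x ℤ.^ m ≡ 0ℤ ⊎ cofactor m (↥ x) (↧ x) ≡ 0ℤ → x ≡ 0ℚ ⊎ x ≡ d/d-1 (suc m)
  conclude (inj₁ ↥x^m≡0) = inj₁ (ℚP.↥p≡0⇒p≡0 x (ℤP.i^n≡0⇒i≡0 (↥ x) m ↥x^m≡0))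
  conclude (inj₂ c≡0)    = inj₂ (cofactor≡0⇒≡d/d-1 k x c≡0)

no-preimage-of-d/d-1 : ∀ {m} x → 2 ≤ m → fpoly (suc m) x ≢ d/d-1 (suc m)
no-preimage-of-d/d-1 {1} _ (s≤s ()) _
no-preimage-of-d/d-1 {m@(suc (suc k))} x m≥2 fx≡y =
  3+k≢1 (∣1⇒≡1 (∣m+n∣m⇒∣n (subst (suc m ∣_) m*m≡[1+k]*d+1 d∣m*m) (n∣m*n (suc k))))
  where
  p = ↥ x
  q = ↧ x
  eq : + m ℤ.* fnum m p q ≡ + suc m ℤ.* q ℤ.^ suc m
  eq = fpoly≡⇒cleared m x (+ suc m) (+ m) (/-*-fromℤ (+ suc m) (suc k)) fx≡y
  ∣p∣^m∣d : ∣ p ∣ ^ m ∣ suc m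
  ∣p∣^m∣d = ↥-power-∣ x m (suc m) (+ m ℤ.* cofactor m p q) (+ suc m) (trans (ℤ*.x∙yz≈y∙xz (p ℤ.^ m) (+ m) _) eq)
  ∣p∣≢0 : ∣ p ∣ ≢ 0
  ∣p∣≢0 ∣p∣≡0 = 1+n≢0 (0∣⇒≡0 (subst (λ a → a ^ m ∣ suc m) ∣p∣≡0 ∣p∣^m∣d))
  ∣p∣≡1 : ∣ p ∣ ≡ 1
  ∣p∣≡1 = ≤-antisym (aᵐ≤1+m⇒a≤1 m≥2 (∣⇒≤ ∣p∣^m∣d)) (n≢0⇒n>0 ∣p∣≢0)
  factor : ∀ q M D pᵐ qᵐ → q ℤ.* (M ℤ.* D ℤ.* pᵐ ℤ.- D ℤ.* qᵐ) ≡ D ℤ.* (q ℤ.* (M ℤ.* pᵐ ℤ.- qᵐ))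
  factor = solve-∀
  d∣m*m : suc m ∣ m * m
  d∣m*m = divides ∣ q ℤ.* (+ m ℤ.* p ℤ.^ m ℤ.- q ℤ.^ m) ∣ (begin
    m * m                                         ≡⟨ *-identityʳ (m * m) ⟨
    m * m * 1                                   ≡⟨ cong (m * m *_) (trans (cong (_^ suc m) ∣p∣≡1) (^-zeroˡ (suc m))) ⟨
    m * m * ∣ p ∣ ^ suc m                      ≡⟨ cong (m * m *_) (abs-^ p (suc m)) ⟨
    m * m * ∣ p ℤ.^ suc m ∣                      ≡⟨ ℤP.abs-* (+ m ℤ.* + m) (p ℤ.^ suc m) ⟨
    ∣ + m ℤ.* + m ℤ.* p ℤ.^ suc m ∣                  ≡⟨ cong ∣_∣ (cleared-rearranged m p q (+ suc m) (+ m) eq) ⟩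
    ∣ q ℤ.* (+ m ℤ.* + suc m ℤ.* p ℤ.^ m ℤ.- + suc m ℤ.* q ℤ.^ m) ∣ ≡⟨ cong ∣_∣ (factor q (+ m) (+ suc m) (p ℤ.^ m) (q ℤ.^ m)) ⟩
    ∣ + suc m ℤ.* (q ℤ.* (+ m ℤ.* p ℤ.^ m ℤ.- q ℤ.^ m)) ∣ ≡⟨ ℤP.abs-* (+ suc m) (q ℤ.* (+ m ℤ.* p ℤ.^ m ℤ.- q ℤ.^ m)) ⟩
    suc m * ∣ q ℤ.* (+ m ℤ.* p ℤ.^ m ℤ.- q ℤ.^ m) ∣   ≡⟨ *-comm (suc m) ∣ q ℤ.* (+ m ℤ.* p ℤ.^ m ℤ.- q ℤ.^ m) ∣ ⟩
    ∣ q ℤ.* (+ m ℤ.* p ℤ.^ m ℤ.- q ℤ.^ m) ∣ * suc m   ∎)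
    where open ≡-Reasoning
  m*m≡[1+k]*d+1 : m * m ≡ suc k * suc m + 1
  m*m≡[1+k]*d+1 = solve (k ∷ [])
  3+k≢1 : suc m ≢ 1
  3+k≢1 ()

preimages-of-±½-candidates : ∀ x {c} A → ∣ A ∣ ≡ 1 → c ℚ.* fromℤ (+ 2) ≡ fromℤ A → fpoly 3 x ≡ c →
  (↥ x ≡ 1ℤ ⊎ ↥ x ≡ -1ℤ) × ↧ₙ x ≤ 4
preimages-of-±½-candidates x A ∣A∣≡1 c*2≡A fx≡c = ↥x≡±1 , ∣⇒≤ ↧ₙx∣4
  where
  eq : + 2 ℤ.* fnum 2 (↥ x) (↧ x) ≡ A ℤ.* ↧ x ℤ.^ 3
  eq = fpoly≡⇒cleared 2 x A (+ 2) c*2≡A fx≡c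
  ↥x≡±1 : ↥ x ≡ 1ℤ ⊎ ↥ x ≡ -1ℤ
  ↥x≡±1 = ↥≡±1 x 1 3 (+ 2 ℤ.* cofactor 2 (↥ x) (↧ x)) A ∣A∣≡1 (trans (ℤ*.x∙yz≈y∙xz (↥ x ℤ.^ 2) (+ 2) _) eq)
  ∣↥x∣≡1 : ∣ ↥ x ∣ ≡ 1
  ∣↥x∣≡1 = [ cong ∣_∣ , cong ∣_∣ ] ↥x≡±1
  ↧ₙx∣4 : ↧ₙ x ∣ 4
  ↧ₙx∣4 = subst (λ a → ↧ₙ x ∣ 2 * 2 * a ^ 3) ∣↥x∣≡1 (↧ₙ-∣ 2 x A (+ 2) eq)

preimages-of-½-cubic : ∀ x → fpoly 3 x ≡ ½ → x ≡ ½
preimages-of-½-cubic x fx≡½ = check x (preimages-of-±½-candidates x 1ℤ refl refl fx≡½) fx≡½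
  where
  -- Every candidate ±1 / n other than ½ is refuted by evaluating f at it.
  check : ∀ x → (↥ x ≡ 1ℤ ⊎ ↥ x ≡ -1ℤ) × ↧ₙ x ≤ 4 → fpoly 3 x ≡ ½ → x ≡ ½
  check (mkℚ _ 1 _) (inj₁ refl , _) _  = refl
  check (mkℚ _ 0 _) (inj₁ refl , _) ()
  check (mkℚ _ 2 _) (inj₁ refl , _) ()
  check (mkℚ _ 3 _) (inj₁ refl , _) ()
  check (mkℚ _ 0 _) (inj₂ refl , _) ()
  check (mkℚ _ 1 _) (inj₂ refl , _) ()
  check (mkℚ _ 2 _) (inj₂ refl , _) ()
  check (mkℚ _ 3 _) (inj₂ refl , _) ()
  check (mkℚ _ (suc (suc (suc (suc _)))) _) (_ , s≤s (s≤s (s≤s (s≤s ())))) _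

no-preimage-of--½-cubic : ∀ x → fpoly 3 x ≢ -½
no-preimage-of--½-cubic x fx≡-½ = check x (preimages-of-±½-candidates x -1ℤ refl refl fx≡-½) fx≡-½
  where
  check : ∀ x → (↥ x ≡ 1ℤ ⊎ ↥ x ≡ -1ℤ) × ↧ₙ x ≤ 4 → fpoly 3 x ≢ -½
  check (mkℚ _ 0 _) (inj₁ refl , _) ()
  check (mkℚ _ 1 _) (inj₁ refl , _) ()
  check (mkℚ _ 2 _) (inj₁ refl , _) ()
  check (mkℚ _ 3 _) (inj₁ refl , _) ()
  check (mkℚ _ 0 _) (inj₂ refl , _) ()
  check (mkℚ _ 1 _) (inj₂ refl , _) ()
  check (mkℚ _ 2 _) (inj₂ refl , _) ()
  check (mkℚ _ 3 _) (inj₂ refl , _) ()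
  check (mkℚ _ (suc (suc (suc (suc _)))) _) (_ , s≤s (s≤s (s≤s (s≤s ())))) _

ListedFixedPoint : ℕ → ℙ¹ → Set
ListedFixedPoint d P = P ≡ fin 0ℚ ⊎ P ≡ fin 1ℚ ⊎ P ≡ ∞ ⊎ (d ≡ 3 × P ≡ fin ½)

ListedTailPoint : ℕ → ℙ¹ → Set
ListedTailPoint d Q = Q ≡ fin (d/d-1 d) ⊎ (d ≡ 3 × Q ≡ fin -½)

Listed : ℕ → ℙ¹ → Set
Listed d P = ListedFixedPoint d P ⊎ ListedTailPoint d P

fin-injective : ∀ {x y} → fin x ≡ fin y → x ≡ y
fin-injective refl = refl

fixed⇒listed : ∀ {m} → 2 ≤ m → ∀ P → IsFixed (suc m) P → ListedFixedPoint (suc m) P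
fixed⇒listed _   ∞       _     = inj₂ (inj₂ (inj₁ refl))
fixed⇒listed m≥2 (fin x) fx≡x with fixed-points x m≥2 (fin-injective fx≡x)
... | inj₁ refl                 = inj₁ refl
... | inj₂ (inj₁ refl)          = inj₂ (inj₁ refl)
... | inj₂ (inj₂ (refl , refl)) = inj₂ (inj₂ (inj₂ (refl , refl)))

listed⇒fixed : ∀ {m} → 1 ≤ m → ∀ P → ListedFixedPoint (suc m) P → IsFixed (suc m) P
listed⇒fixed {suc k} _ _ (inj₁ refl)                         = cong fin (fpoly-0 k)
listed⇒fixed {m}     _ _ (inj₂ (inj₁ refl))                  = cong fin (fpoly-1 m)
listed⇒fixed         _ _ (inj₂ (inj₂ (inj₁ refl)))           = refl
listed⇒fixed         _ _ (inj₂ (inj₂ (inj₂ (refl , refl)))) = refl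

listed-preimage : ∀ {m} → 2 ≤ m → ∀ Q → Listed (suc m) (f (suc m) Q) → Listed (suc m) Q
listed-preimage _ ∞ _ = inj₁ (inj₂ (inj₂ (inj₁ refl)))
listed-preimage m≥2 (fin x) (inj₁ (inj₁ fx≡0)) with preimages-of-0 x (≤-trans (s≤s z≤n) m≥2) (fin-injective fx≡0)
... | inj₁ refl = inj₁ (inj₁ refl)
... | inj₂ refl = inj₂ (inj₁ refl)
listed-preimage m≥2 (fin x) (inj₁ (inj₂ (inj₁ fx≡1))) with preimages-of-1 x m≥2 (fin-injective fx≡1)
... | inj₁ refl          = inj₁ (inj₂ (inj₁ refl))
... | inj₂ (refl , refl) = inj₂ (inj₂ (refl , refl))
listed-preimage _ (fin x) (inj₁ (inj₂ (inj₂ (inj₁ ()))))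
listed-preimage _ (fin x) (inj₁ (inj₂ (inj₂ (inj₂ (refl , fx≡½))))) =
  inj₁ (inj₂ (inj₂ (inj₂ (refl , cong fin (preimages-of-½-cubic x (fin-injective fx≡½))))))
listed-preimage m≥2 (fin x) (inj₂ (inj₁ fx≡y)) = ⊥-elim (no-preimage-of-d/d-1 x m≥2 (fin-injective fx≡y))
listed-preimage _ (fin x) (inj₂ (inj₂ (refl , fx≡-½))) = ⊥-elim (no-preimage-of--½-cubic x (fin-injective fx≡-½))

listed-backward-orbit : ∀ {m} → 2 ≤ m → ∀ n Q → Listed (suc m) (iter (suc m) n Q) → Listed (suc m) Q
listed-backward-orbit     _   zero    _ listed = listed
listed-backward-orbit {m} m≥2 (suc n) Q listed = listed-backward-orbit m≥2 n Q (listed-preimage m≥2 (iter (suc m) n Q) listed)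

TailPoint : ℕ → ℙ¹ → Set
TailPoint d Q = Σ ℙ¹ (λ P → IsFixed d P × InBackwardOrbit d P Q) × ¬ IsFixed d Q

tail⇒listed : ∀ {m} → 2 ≤ m → ∀ Q → TailPoint (suc m) Q → ListedTailPoint (suc m) Q
tail⇒listed {m} m≥2 Q ((P , P-fixed , n , fⁿ⁺¹Q≡P) , Q-not-fixed)
  with listed-backward-orbit m≥2 (suc n) Q (subst (Listed (suc m)) (sym fⁿ⁺¹Q≡P) (inj₁ (fixed⇒listed m≥2 P P-fixed)))
... | inj₁ Q-listed-fixed = ⊥-elim (Q-not-fixed (listed⇒fixed (≤-trans (s≤s z≤n) m≥2) Q Q-listed-fixed))
... | inj₂ Q-listed-tail  = Q-listed-tail

listed⇒tail : ∀ {m} → 1 ≤ m → ∀ Q → ListedTailPoint (suc m) Q → TailPoint (suc m) Q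
listed⇒tail {suc k} _ _ (inj₁ refl) =
  (fin 0ℚ , cong fin (fpoly-0 k) , 0 , cong fin (fpoly-d/d-1 k)) ,
  λ y-fixed → d/d-1≢0 k (trans (sym (fin-injective y-fixed)) (fpoly-d/d-1 k))
listed⇒tail _ _ (inj₂ (refl , refl)) = (fin 1ℚ , refl , 0 , refl) , λ ()

proposition6p5 : (d : ℕ) → 3 ≤ d →
    ((P : ℙ¹) → IsFixed d P ⇔
       (P ≡ fin 0ℚ ⊎ P ≡ fin 1ℚ ⊎ P ≡ ∞ ⊎ (d ≡ 3 × P ≡ fin ½)))
    ×
    ((Q : ℙ¹) → (Σ ℙ¹ (λ P → IsFixed d P × InBackwardOrbit d P Q) × ¬ IsFixed d Q) ⇔
       (Q ≡ fin (d/d-1 d) ⊎ (d ≡ 3 × Q ≡ fin -½)))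
proposition6p5 (suc m) (s≤s m≥2) =
  (λ P → mk⇔ (fixed⇒listed m≥2 P) (listed⇒fixed m≥1 P)) ,
  (λ Q → mk⇔ (tail⇒listed m≥2 Q) (listed⇒tail m≥1 Q))
  where
  m≥1 = ≤-trans (s≤s z≤n) m≥2
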